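{- For every $n\ge 1$, the burning number of the directed cycle $C_n$ on $n$ nodes is $\left\lceil \sqrt{2n+\frac{1}{4}}-\frac{1}{2}\right\rceil$.
   Context: Burning process on a digraph $D$: a sequence $(x_1,\ldots,x_b)$ of nodes is a burning sequence for $D$ if after $b$ steps of the following process every node of $D$ is burned. In the $i$-th step, first all out-neighbours of all currently burned nodes become burned, and then the node $x_i$ is burned (so after step 1 only $x_1$ is burned). The burning number of $D$ is the length of a shortest burning sequence for $D$. The directed cycle $C_n$ has nodes $v_1,\ldots,v_n$ and arcs $(v_i,v_{i+1})$ for $1\le i<n$ together with $(v_n,v_1)$. -}

module Defs where

open import Data.Nat using (ℕ; zero; suc; _+_; _*_; _∸_; _≤_; _<_)
open import Data.Fin using (Fin)
open import Data.Fin.Base using (toℕ)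
open import Data.Vec using (Vec; []; _∷_; lookup)
open import Data.Product using (Σ; ∃; _×_; _,_)
open import Data.Sum using (_⊎_)
open import Relation.Binary.PropositionalEquality using (_≡_)

record Digraph : Set₁ where
  field
    Node : Set
    Arc  : Node → Node → Set
open Digraph public

-- Burned D x i v : after step (suc i) of the burning process with sequence x
-- (indexed from step 1 = index zero), node v is burned.
data Burned (D : Digraph) {b : ℕ} (x : Fin b → Node D) : ℕ → Node D → Set where
  lit    : ∀ {i} (j : Fin b) → toℕ j ≡ i → ∀ {v} → x j ≡ v → Burned D x i v
  stay   : ∀ {i v} → Burned D x i v → Burned D x (suc i) v
  spread : ∀ {i u v} → Burned D x i u → Arc D u v → Burned D x (suc i) v

IsBurningSequence : (D : Digraph) {b : ℕ} → (Fin b → Node D) → Set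
IsBurningSequence D {zero}  x = ∀ (v : Node D) → Fin 0
IsBurningSequence D {suc b} x = ∀ (v : Node D) → Burned D x b v

BurningNumber : Digraph → ℕ → Set
BurningNumber D k =
  (Σ (Fin k → Node D) λ x → IsBurningSequence D x) ×
  (∀ (b : ℕ) (x : Fin b → Node D) → IsBurningSequence D x → k ≤ b)

-- The directed cycle C_n on nodes Fin n (node i ↔ v_{i+1}):
-- arcs i → i+1 for i+1 < n and n-1 → 0.
CycleArc : (n : ℕ) → Fin n → Fin n → Set
CycleArc n u v = (suc (toℕ u) ≡ toℕ v) ⊎ ((suc (toℕ u) ≡ n) × (toℕ v ≡ 0))

C : ℕ → Digraph
C n = record { Node = Fin n ; Arc = CycleArc n }

-- ⌈ √(2n + 1/4) − 1/2 ⌉ = k  ⇔  k is the least natural with k(k+1) ≥ 2n,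
-- i.e.  2n ≤ k(k+1)  and  (k−1)k < 2n  (for n ≥ 1).
IsCeilSqrtExpr : ℕ → ℕ → Set
IsCeilSqrtExpr n k = (2 * n ≤ k * suc k) × ((k ∸ 1) * k < 2 * n)

{-# OPTIONS --safe #-}
-- On a digraph in which every node has at most one out-neighbour, a node burned after
-- b steps is determined by the source x_j that reached it and the distance d travelled,
-- where j + d < b; there are only tri b = b(b+1)/2 such pairs, so n ≤ b(b+1)/2.
-- Conversely, on C_n the sources x_j = tri (k - j) (0-indexed, for j ≤ k) burn the
-- consecutive blocks [tri (k - j), tri (k - j + 1)), which together tile [0, tri (k + 1)).
module Submission where

open import Defs
open import Data.Nat using (ℕ; zero; suc; _+_; _*_; _∸_; _≤_; _<_; _≤′_; ≤′-refl; ≤′-step; z≤n; s≤s; s≤s⁻¹; NonZero)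
open import Data.Nat.Properties
open import Data.Nat.DivMod using (_mod_; _%_; m<n⇒m%n≡m)
open import Data.Nat.Solver using (module +-*-Solver)
open import Data.Fin using (Fin; toℕ; fromℕ<)
open import Data.Fin.Properties using (¬Fin0; toℕ-injective; toℕ<n; toℕ-fromℕ<; fromℕ<-injective; injective⇒≤)
open import Data.Product using (∃₂; _×_; _,_)
open import Data.Sum using (inj₁; inj₂)
open import Relation.Binary.Definitions using (tri<; tri≈; tri>)
open import Relation.Binary.Rewriting using (Deterministic)
open import Relation.Binary.PropositionalEquality
open import Relation.Nullary using (contradiction)

tri : ℕ → ℕ
tri zero    = 0
tri (suc a) = tri a + suc a

2*tri[a]≡a*[1+a] : ∀ a → 2 * tri a ≡ a * suc a
2*tri[a]≡a*[1+a] zero    = refl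
2*tri[a]≡a*[1+a] (suc a) = begin
  2 * (tri a + suc a)     ≡⟨ *-distribˡ-+ 2 (tri a) (suc a) ⟩
  2 * tri a + 2 * suc a   ≡⟨ cong (_+ 2 * suc a) (2*tri[a]≡a*[1+a] a) ⟩
  a * suc a + 2 * suc a   ≡⟨ solve 1 (λ a → a :* (con 1 :+ a) :+ con 2 :* (con 1 :+ a)
                                          := (con 1 :+ a) :* (con 2 :+ a)) refl a ⟩
  suc a * suc (suc a)     ∎
  where open ≡-Reasoning; open +-*-Solver

tri-mono-≤ : ∀ {a c} → a ≤ c → tri a ≤ tri c
tri-mono-≤ z≤n       = z≤n
tri-mono-≤ (s≤s a≤c) = +-mono-≤ (tri-mono-≤ a≤c) (s≤s a≤c)

tri-cancel-< : ∀ {a c} → tri a < tri c → a < c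
tri-cancel-< lt = ≰⇒> (λ c≤a → <⇒≱ lt (tri-mono-≤ c≤a))

tri[a]+d<tri[1+a] : ∀ {a d} → d ≤ a → tri a + d < tri (suc a)
tri[a]+d<tri[1+a] {a} d≤a = +-monoʳ-< (tri a) (s≤s d≤a)

tri[a]+d<tri[a′]+d′ : ∀ {a a′ d} d′ → d ≤ a → a < a′ → tri a + d < tri a′ + d′
tri[a]+d<tri[a′]+d′ d′ d≤a a<a′ =
  <-≤-trans (tri[a]+d<tri[1+a] d≤a) (≤-trans (tri-mono-≤ a<a′) (m≤m+n _ d′))

tri+-injective : ∀ {a a′ d d′} → d ≤ a → d′ ≤ a′ →
                 tri a + d ≡ tri a′ + d′ → a ≡ a′ × d ≡ d′
tri+-injective {a} {a′} {d} {d′} d≤a d′≤a′ eq with <-cmp a a′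
... | tri< a<a′ _ _ = contradiction eq (<⇒≢ (tri[a]+d<tri[a′]+d′ d′ d≤a a<a′))
... | tri> _ _ a′<a = contradiction (sym eq) (<⇒≢ (tri[a]+d<tri[a′]+d′ d d′≤a′ a′<a))
... | tri≈ _ refl _ = refl , +-cancelˡ-≡ (tri a) d d′ eq

≤tri⇒2*≤a*[1+a] : ∀ {m} a → m ≤ tri a → 2 * m ≤ a * suc a
≤tri⇒2*≤a*[1+a] {m} a m≤tri = subst (2 * m ≤_) (2*tri[a]≡a*[1+a] a) (*-monoʳ-≤ 2 m≤tri)

2*≤a*[1+a]⇒≤tri : ∀ {m} a → 2 * m ≤ a * suc a → m ≤ tri a
2*≤a*[1+a]⇒≤tri {m} a 2m≤ = *-cancelˡ-≤ 2 (subst (2 * m ≤_) (sym (2*tri[a]≡a*[1+a] a)) 2m≤)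

[k∸1]*k<m≤b*[1+b]⇒k≤b : ∀ {k b m} → (k ∸ 1) * k < m → m ≤ b * suc b → k ≤ b
[k∸1]*k<m≤b*[1+b]⇒k≤b lt le = ≮⇒≥ λ b<k → <⇒≱ lt (≤-trans le (*-mono-≤ (∸-monoˡ-≤ 1 b<k) b<k))

triangularRoot : ∀ t → ∃₂ λ a d → d ≤ a × tri a + d ≡ t
triangularRoot zero = 0 , 0 , z≤n , refl
triangularRoot (suc t) with triangularRoot t
... | a , d , d≤a , refl with m≤n⇒m<n∨m≡n d≤a
...   | inj₁ d<a  = a , suc d , d<a , +-suc (tri a) d
...   | inj₂ refl = suc a , 0 , z≤n , trans (+-identityʳ _) (+-suc (tri a) a)

data Walk (D : Digraph) (u : Node D) : ℕ → Node D → Set where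
  []  : Walk D u 0 u
  _▷_ : ∀ {d v w} → Walk D u d v → Arc D v w → Walk D u (suc d) w

walk-deterministic : ∀ {D : Digraph} → Deterministic _≡_ (Arc D) →
                     ∀ {u d v w} → Walk D u d v → Walk D u d w → v ≡ w
walk-deterministic det []      []      = refl
walk-deterministic det (p ▷ a) (q ▷ b) with refl ← walk-deterministic det p q = det a b

module _ {D : Digraph} {b : ℕ} {x : Fin b → Node D} where

  Burned-mono : ∀ {i i′ v} → i ≤′ i′ → Burned D x i v → Burned D x i′ v
  Burned-mono ≤′-refl       p = p
  Burned-mono (≤′-step i≤i′) p = stay (Burned-mono i≤i′ p)

  burned⇒walk : ∀ {i v} → Burned D x i v →
                ∃₂ λ (j : Fin b) d → toℕ j + d ≤ i × Walk D (x j) d v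
  burned⇒walk (lit j refl refl) = j , 0 , ≤-reflexive (+-identityʳ (toℕ j)) , []
  burned⇒walk (stay p) with burned⇒walk p
  ... | j , d , j+d≤i , w = j , d , m≤n⇒m≤1+n j+d≤i , w
  burned⇒walk (spread p a) with burned⇒walk p
  ... | j , d , j+d≤i , w = j , suc d , ≤-trans (≤-reflexive (+-suc (toℕ j) d)) (s≤s j+d≤i) , w ▷ a

module _ {n : ℕ} {Arc : Fin n → Fin n → Set} (det : Deterministic _≡_ Arc) where

  private
    D : Digraph
    D = record { Node = Fin n ; Arc = Arc }

  burningSequence⇒≤tri : ∀ {b} (x : Fin b → Fin n) → IsBurningSequence D x → n ≤ tri b
  burningSequence⇒≤tri {zero}  x burns =
    injective⇒≤ {f = burns} λ {v} _ → contradiction (burns v) ¬Fin0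
  burningSequence⇒≤tri {suc b} x burns =
    injective⇒≤ {f = code} λ {v} {v′} → pair-injective (witness v) (witness v′)
    where
    Witness : Fin n → Set
    Witness v = ∃₂ λ (j : Fin (suc b)) d → toℕ j + d ≤ b × Walk D (x j) d v

    witness : ∀ v → Witness v
    witness v = burned⇒walk (burns v)

    -- the pair (j, d) is stored as (a, d) with a = j + d, which satisfies d ≤ a < suc b
    pair : ∀ {v} → Witness v → Fin (tri (suc b))
    pair (j , d , j+d≤b , _) =
      fromℕ< (<-≤-trans (tri[a]+d<tri[1+a] (m≤n+m d (toℕ j))) (tri-mono-≤ (s≤s j+d≤b)))

    code : Fin n → Fin (tri (suc b))
    code v = pair (witness v)

    pair-injective : ∀ {v v′} (p : Witness v) (q : Witness v′) → pair p ≡ pair q → v ≡ v′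
    pair-injective (j , d , _ , w) (j′ , d′ , _ , w′) eq
      with tri+-injective (m≤n+m d (toℕ j)) (m≤n+m d′ (toℕ j′)) (fromℕ<-injective _ _ _ _ eq)
    ... | j+d≡j′+d′ , refl with refl ← toℕ-injective (+-cancelʳ-≡ d (toℕ j) (toℕ j′) j+d≡j′+d′) =
      walk-deterministic det w w′

cycle-deterministic : ∀ {n} → Deterministic _≡_ (CycleArc n)
cycle-deterministic (inj₁ u+1≡v) (inj₁ u+1≡w) = toℕ-injective (trans (sym u+1≡v) u+1≡w)
cycle-deterministic {y = v} (inj₁ u+1≡v) (inj₂ (u+1≡n , _)) =
  contradiction (trans (sym u+1≡v) u+1≡n) (<⇒≢ (toℕ<n v))
cycle-deterministic {z = w} (inj₂ (u+1≡n , _)) (inj₁ u+1≡w) =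
  contradiction (trans (sym u+1≡w) u+1≡n) (<⇒≢ (toℕ<n w))
cycle-deterministic (inj₂ (_ , v≡0)) (inj₂ (_ , w≡0)) = toℕ-injective (trans v≡0 (sym w≡0))

module _ {n b : ℕ} {x : Fin b → Fin n} where

  burned-cycle-forward : ∀ d {i u} (w : Fin n) → toℕ u + d ≡ toℕ w →
                         Burned (C n) x i u → Burned (C n) x (d + i) w
  burned-cycle-forward zero w u+0≡w p =
    subst (Burned (C n) x _) (toℕ-injective (trans (sym (+-identityʳ _)) u+0≡w)) p
  burned-cycle-forward (suc d) {u = u} w u+1+d≡w p =
    spread (burned-cycle-forward d w′ (sym (toℕ-fromℕ< u+d<n)) p)
           (inj₁ (trans (cong suc (toℕ-fromℕ< u+d<n)) u+d+1≡w))
    where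
    u+d+1≡w : suc (toℕ u + d) ≡ toℕ w
    u+d+1≡w = trans (sym (+-suc (toℕ u) d)) u+1+d≡w

    u+d<n : toℕ u + d < n
    u+d<n = <-trans (≤-reflexive u+d+1≡w) (toℕ<n w)

    w′ : Fin n
    w′ = fromℕ< u+d<n

triangularSequence : (n k : ℕ) .{{_ : NonZero n}} → Fin (suc k) → Fin n
triangularSequence n k j = tri (k ∸ toℕ j) mod n

triangularSequence-burns : ∀ {n k} .{{_ : NonZero n}} → n ≤ tri (suc k) →
                           IsBurningSequence (C n) (triangularSequence n k)
triangularSequence-burns {n} {k} n≤tri v with triangularRoot (toℕ v)
... | a , d , d≤a , tri[a]+d≡v =
  Burned-mono (≤⇒≤′ d+j≤k) (burned-cycle-forward d v source+d≡v (lit j refl refl))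
  where
  tri[a]+d<n : tri a + d < n
  tri[a]+d<n = subst (_< n) (sym tri[a]+d≡v) (toℕ<n v)

  a≤k : a ≤ k
  a≤k = s≤s⁻¹ (tri-cancel-< (≤-<-trans (m≤m+n (tri a) d) (<-≤-trans tri[a]+d<n n≤tri)))

  j : Fin (suc k)
  j = fromℕ< (s≤s (m∸n≤m k a))

  j≡k∸a : toℕ j ≡ k ∸ a
  j≡k∸a = toℕ-fromℕ< _

  source≡tri[a] : toℕ (triangularSequence n k j) ≡ tri a
  source≡tri[a] = begin
    toℕ (tri (k ∸ toℕ j) mod n)  ≡⟨ toℕ-fromℕ< _ ⟩
    tri (k ∸ toℕ j) % n          ≡⟨ cong (λ i → tri (k ∸ i) % n) j≡k∸a ⟩
    tri (k ∸ (k ∸ a)) % n        ≡⟨ cong (λ i → tri i % n) (m∸[m∸n]≡n a≤k) ⟩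
    tri a % n                    ≡⟨ m<n⇒m%n≡m (≤-<-trans (m≤m+n (tri a) d) tri[a]+d<n) ⟩
    tri a                        ∎
    where open ≡-Reasoning

  source+d≡v : toℕ (triangularSequence n k j) + d ≡ toℕ v
  source+d≡v = trans (cong (_+ d) source≡tri[a]) tri[a]+d≡v

  d+j≤k : d + toℕ j ≤ k
  d+j≤k = begin
    d + toℕ j    ≡⟨ cong (d +_) j≡k∸a ⟩
    d + (k ∸ a)  ≤⟨ +-monoˡ-≤ (k ∸ a) d≤a ⟩
    a + (k ∸ a)  ≡⟨ m+[n∸m]≡n a≤k ⟩
    k            ∎
    where open ≤-Reasoning

mainTheorem6 : ∀ (n k : ℕ) → 1 ≤ n → IsCeilSqrtExpr n k → BurningNumber (C n) k
mainTheorem6 (suc _)   zero    _ (() , _)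
mainTheorem6 n@(suc _) (suc k) _ (2n≤k[1+k] , [k∸1]k<2n) = (sequence , burns) , minimal
  where
  sequence : Fin (suc k) → Fin n
  sequence = triangularSequence n k

  burns : IsBurningSequence (C n) sequence
  burns = triangularSequence-burns (2*≤a*[1+a]⇒≤tri (suc k) 2n≤k[1+k])

  minimal : ∀ b (x : Fin b → Fin n) → IsBurningSequence (C n) x → suc k ≤ b
  minimal b x burns-x = [k∸1]*k<m≤b*[1+b]⇒k≤b [k∸1]k<2n
    (≤tri⇒2*≤a*[1+a] b (burningSequence⇒≤tri cycle-deterministic x burns-x))
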